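{- For positive integers $m$ and $n>1$, $\chi_{ld}(K_m[\overline{K_n}])=m$.
   Context: For a graph $G=(V,E)$ of order $N$ and a bijection $f\colon V\to\{1,\dots,N\}$, the weight of a vertex $u$ is $w(u)=\sum_{x\in N(u)}f(x)$, where $N(u)$ is the open neighborhood of $u$. The bijection $f$ is a local distance antimagic labeling if $w(u)\neq w(v)$ for every edge $uv$. $\chi_{ld}(G)$ is the minimum number of distinct weights over all local distance antimagic labelings of $G$. $K_m$ is the complete graph on $m$ vertices; $\overline{K_n}$ is the edgeless graph on $n$ vertices. The lexicographic product $G[H]$ has vertex set $V(G)\times V(H)$, with $(g,h)$ adjacent to $(g',h')$ iff $gg'\in E(G)$, or $g=g'$ and $hh'\in E(H)$. -}

module Defs where

open import Data.Nat using (ℕ; zero; suc; _+_; _*_; _≤_)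
open import Data.Nat.Properties using (_≟_)
open import Data.Fin using (Fin; toℕ; remQuot)
open import Data.Fin.Permutation using (Permutation′; _⟨$⟩ʳ_)
open import Data.Bool using (Bool; true; false; if_then_else_; _∧_; _∨_; not)
open import Data.List using (List; length; map; allFin; deduplicate)
open import Data.Product using (Σ; _×_; _,_; proj₁; proj₂)
open import Relation.Binary.PropositionalEquality using (_≡_; _≢_; refl; sym; cong; cong₂)
open import Relation.Nullary.Decidable using (⌊_⌋; yes; no)
import Data.Fin.Properties as FinP

record Graph : Set where
  field
    order : ℕ
    adj   : Fin order → Fin order → Bool
    adj-sym : ∀ u v → adj u v ≡ adj v u
    adj-irr : ∀ u → adj u u ≡ false
open Graph public

sumFin : (n : ℕ) → (Fin n → ℕ) → ℕ
sumFin zero    g = 0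
sumFin (suc n) g = g Fin.zero + sumFin n (λ i → g (Fin.suc i))

-- A labeling is a bijection f : V → {1,…,N}; we use a permutation π of
-- Fin N and put f(x) = toℕ (π x) + 1.
Labeling : Graph → Set
Labeling G = Permutation′ (order G)

label : (G : Graph) → Labeling G → Fin (order G) → ℕ
label G f x = suc (toℕ (f ⟨$⟩ʳ x))

weight : (G : Graph) → Labeling G → Fin (order G) → ℕ
weight G f u = sumFin (order G) (λ x → if adj G u x then label G f x else 0)

IsLDAL : (G : Graph) → Labeling G → Set
IsLDAL G f = ∀ u v → adj G u v ≡ true → weight G f u ≢ weight G f v

numWeights : (G : Graph) → Labeling G → ℕ
numWeights G f = length (deduplicate _≟_ (map (weight G f) (allFin (order G))))

ChiLdEquals : Graph → ℕ → Set
ChiLdEquals G k =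
  (Σ (Labeling G) λ f → IsLDAL G f × numWeights G f ≡ k)
  × (∀ (f : Labeling G) → IsLDAL G f → k ≤ numWeights G f)

private
  eqb : ∀ {m} → Fin m → Fin m → Bool
  eqb i j = ⌊ FinP._≟_ i j ⌋

  eqb-sym : ∀ {m} (i j : Fin m) → eqb i j ≡ eqb j i
  eqb-sym i j with FinP._≟_ i j | FinP._≟_ j i
  ... | yes _ | yes _ = refl
  ... | no _  | no _  = refl
  ... | yes p | no q  = Data.Empty.⊥-elim (q (sym p))
    where import Data.Empty
  ... | no p  | yes q = Data.Empty.⊥-elim (p (sym q))
    where import Data.Empty

  eqb-refl : ∀ {m} (i : Fin m) → eqb i i ≡ true
  eqb-refl i with FinP._≟_ i i
  ... | yes _ = refl
  ... | no p  = Data.Empty.⊥-elim (p refl)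
    where import Data.Empty

K : ℕ → Graph
K m = record
  { order = m
  ; adj = λ i j → not (eqb i j)
  ; adj-sym = λ i j → cong not (eqb-sym i j)
  ; adj-irr = λ i → cong not (eqb-refl i) }

Kbar : ℕ → Graph
Kbar n = record
  { order = n
  ; adj = λ _ _ → false
  ; adj-sym = λ _ _ → refl
  ; adj-irr = λ _ → refl }

-- lexicographic product G[H]; vertex set Fin (|G| * |H|) ≅ V(G) × V(H)
-- via remQuot (inverse of combine).
lexAdj : (G H : Graph) → Fin (order G * order H) → Fin (order G * order H) → Bool
lexAdj G H x y =
  adj G (proj₁ gx) (proj₁ gy) ∨ (eqb (proj₁ gx) (proj₁ gy) ∧ adj H (proj₂ gx) (proj₂ gy))
  where
    gx = remQuot {order G} (order H) x
    gy = remQuot {order G} (order H) y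

lex : Graph → Graph → Graph
lex G H = record
  { order = order G * order H
  ; adj = lexAdj G H
  ; adj-sym = λ x y →
      let gx = remQuot {order G} (order H) x
          gy = remQuot {order G} (order H) y
      in cong₂ _∨_ (adj-sym G (proj₁ gx) (proj₁ gy))
           (cong₂ _∧_ (eqb-sym (proj₁ gx) (proj₁ gy)) (adj-sym H (proj₂ gx) (proj₂ gy)))
  ; adj-irr = λ x →
      let gx = remQuot {order G} (order H) x
      in helper (adj G (proj₁ gx) (proj₁ gx)) (adj-irr G (proj₁ gx))
                (eqb (proj₁ gx) (proj₁ gx)) (adj H (proj₂ gx) (proj₂ gx)) (adj-irr H (proj₂ gx)) }
  where
    helper : ∀ a → a ≡ false → ∀ b c → c ≡ false → a ∨ (b ∧ c) ≡ false
    helper .false refl false .false refl = refl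
    helper .false refl true  .false refl = refl

{-# OPTIONS --safe #-}
-- In K_m[K̄_n] a vertex is adjacent exactly to the vertices outside its own part, so its
-- weight is the total label sum minus the label sum of its part.  Weights are therefore
-- constant on parts, and since vertices of distinct parts are adjacent, a labeling is local
-- distance antimagic iff its m part sums are distinct, in which case it has exactly m
-- weights.  Numbering the parts as consecutive blocks gives the part sums
-- n²a + n(n+1)/2 (a < m), which are distinct.
module Submission where

open import Defs
open import Data.Nat using (ℕ; _<_; _≤_; zero; suc; _+_; _*_)
import Data.Nat.Properties as ℕ
open import Data.Nat.Properties using (+-assoc; +-comm; +-suc; +-cancelˡ-≡; +-cancelʳ-≡; *-cancelˡ-≡; ≤-reflexive)
open import Algebra.Properties.CommutativeSemigroup ℕ.+-commutativeSemigroup using (interchange)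
open import Data.Fin using (Fin; zero; suc; toℕ; combine; remQuot; _↑ˡ_; _↑ʳ_)
open import Data.Fin.Properties using (_≟_; remQuot-combine; toℕ-combine; toℕ-injective)
import Data.Fin.Permutation as Permutation
open import Data.Bool using (true; false; if_then_else_; not; _∨_)
open import Data.Bool.Properties using (∧-zeroʳ; ∨-identityʳ)
open import Data.List using (List; length; map; allFin; deduplicate; tabulate)
open import Data.List.Properties using (length-tabulate)
open import Data.List.Membership.Propositional using (_∈_)
open import Data.List.Membership.Propositional.Properties
  using (∈-map⁺; ∈-map⁻; ∈-tabulate⁺; ∈-tabulate⁻; ∈-allFin; deduplicate-∈⇔)
open import Data.List.Membership.Propositional.Properties.WithK using (unique∧set⇒bag)
open import Data.List.Relation.Binary.BagAndSetEquality using (∼bag⇒↭)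
open import Data.List.Relation.Binary.Permutation.Propositional.Properties using (↭-length)
open import Data.List.Relation.Unary.Unique.Propositional using (Unique)
open import Data.List.Relation.Unary.Unique.Propositional.Properties using (tabulate⁺)
import Data.List.Relation.Unary.Unique.DecPropositional.Properties as UniqueDec
open import Data.Product using (_,_; proj₁)
open import Function using (_∘_; _⇔_; mk⇔; Equivalence)
open import Function.Definitions using (Injective)
open import Relation.Nullary using (yes; no)
open import Data.Empty using (⊥-elim)
open import Relation.Nullary.Decidable using (⌊_⌋; isYes≗does)
open import Relation.Binary.Definitions using (DecidableEquality)
open import Relation.Binary.PropositionalEquality

sumFin-cong : ∀ k {g h : Fin k → ℕ} → g ≗ h → sumFin k g ≡ sumFin k h
sumFin-cong zero    g≗h = refl
sumFin-cong (suc k) g≗h = cong₂ _+_ (g≗h zero) (sumFin-cong k (g≗h ∘ suc))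

sumFin-zero : ∀ k → sumFin k (λ _ → 0) ≡ 0
sumFin-zero zero    = refl
sumFin-zero (suc k) = sumFin-zero k

sumFin-const : ∀ k c → sumFin k (λ _ → c) ≡ k * c
sumFin-const zero    c = refl
sumFin-const (suc k) c = cong (c +_) (sumFin-const k c)

sumFin-+ : ∀ k (g h : Fin k → ℕ) → sumFin k (λ x → g x + h x) ≡ sumFin k g + sumFin k h
sumFin-+ zero    g h = refl
sumFin-+ (suc k) g h = trans (cong (g zero + h zero +_) (sumFin-+ k (g ∘ suc) (h ∘ suc)))
                             (interchange (g zero) (h zero) (sumFin k (g ∘ suc)) (sumFin k (h ∘ suc)))

sumFin-if : ∀ k b (g : Fin k → ℕ) → sumFin k (λ x → if b then g x else 0) ≡ (if b then sumFin k g else 0)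
sumFin-if k true  g = refl
sumFin-if k false g = sumFin-zero k

sumFin-splitAt : ∀ p q (g : Fin (p + q) → ℕ) →
                 sumFin (p + q) g ≡ sumFin p (g ∘ (_↑ˡ q)) + sumFin q (g ∘ (p ↑ʳ_))
sumFin-splitAt zero    q g = refl
sumFin-splitAt (suc p) q g = trans (cong (g zero +_) (sumFin-splitAt p q (g ∘ suc))) (sym (+-assoc (g zero) _ _))

sumFin-combine : ∀ m n (g : Fin (m * n) → ℕ) →
                 sumFin (m * n) g ≡ sumFin m (λ a → sumFin n (λ b → g (combine a b)))
sumFin-combine zero    n g = refl
sumFin-combine (suc m) n g = trans (sumFin-splitAt n (m * n) g)
                                   (cong (sumFin n (g ∘ (_↑ˡ (m * n))) +_) (sumFin-combine m n (g ∘ (n ↑ʳ_))))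

⌊suc≟suc⌋ : ∀ {k} (i a : Fin k) → ⌊ suc i ≟ suc a ⌋ ≡ ⌊ i ≟ a ⌋
⌊suc≟suc⌋ i a = trans (isYes≗does (suc i ≟ suc a)) (sym (isYes≗does (i ≟ a)))

sumFin-except : ∀ k (g : Fin k → ℕ) i →
                sumFin k (λ a → if not ⌊ i ≟ a ⌋ then g a else 0) + g i ≡ sumFin k g
sumFin-except (suc k) g zero    = +-comm (sumFin k (g ∘ suc)) (g zero)
sumFin-except (suc k) g (suc i) = begin
  (g zero + sumFin k (λ a → if not ⌊ suc i ≟ suc a ⌋ then g (suc a) else 0)) + g (suc i)
    ≡⟨ +-assoc (g zero) _ (g (suc i)) ⟩
  g zero + (sumFin k (λ a → if not ⌊ suc i ≟ suc a ⌋ then g (suc a) else 0) + g (suc i))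
    ≡⟨ cong (λ s → g zero + (s + g (suc i)))
            (sumFin-cong k (λ a → cong (λ b → if not b then g (suc a) else 0) (⌊suc≟suc⌋ i a))) ⟩
  g zero + (sumFin k (λ a → if not ⌊ i ≟ a ⌋ then g (suc a) else 0) + g (suc i))
    ≡⟨ cong (g zero +_) (sumFin-except k (g ∘ suc) i) ⟩
  g zero + sumFin k (g ∘ suc) ∎
  where open ≡-Reasoning

length-unique-≡ : ∀ {a} {A : Set a} {xs ys : List A} → Unique xs → Unique ys →
                  (∀ {z} → z ∈ xs ⇔ z ∈ ys) → length xs ≡ length ys
length-unique-≡ xs! ys! xs⇔ys = ↭-length (∼bag⇒↭ (unique∧set⇒bag xs! ys! xs⇔ys))

length-deduplicate-image : ∀ {a} {A : Set a} (_≟ᴬ_ : DecidableEquality A) {k m}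
  (g : Fin k → A) (W : Fin m → A) (p : Fin k → Fin m) (s : Fin m → Fin k) →
  g ≗ W ∘ p → W ≗ g ∘ s → Injective _≡_ _≡_ W →
  length (deduplicate _≟ᴬ_ (map g (allFin k))) ≡ m
length-deduplicate-image _≟ᴬ_ {k} {m} g W p s g≗Wp W≗gs W-inj = begin
  length (deduplicate _≟ᴬ_ (map g (allFin k)))
    ≡⟨ length-unique-≡ (UniqueDec.deduplicate-! _≟ᴬ_ _) (tabulate⁺ W-inj) (mk⇔ image⊆ image⊇) ⟩
  length (tabulate W)
    ≡⟨ length-tabulate W ⟩
  m ∎
  where
    open ≡-Reasoning
    image⊆ : ∀ {z} → z ∈ deduplicate _≟ᴬ_ (map g (allFin k)) → z ∈ tabulate W
    image⊆ z∈ with ∈-map⁻ g (Equivalence.from (deduplicate-∈⇔ _≟ᴬ_) z∈)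
    ... | u , _ , refl = subst (_∈ tabulate W) (sym (g≗Wp u)) (∈-tabulate⁺ (p u))
    image⊇ : ∀ {z} → z ∈ tabulate W → z ∈ deduplicate _≟ᴬ_ (map g (allFin k))
    image⊇ z∈ with ∈-tabulate⁻ z∈
    ... | i , refl = Equivalence.to (deduplicate-∈⇔ _≟ᴬ_)
                       (subst (_∈ map g (allFin k)) (sym (W≗gs i)) (∈-map⁺ g (∈-allFin (s i))))

-- Parametrised by n-1 so that every part is nonempty and has a corner.
module CompleteMultipartite (m n-1 : ℕ) where

  n : ℕ
  n = suc n-1

  G : Graph
  G = lex (K m) (Kbar n)

  part : Fin (m * n) → Fin m
  part u = proj₁ (remQuot {m} n u)

  part-combine : ∀ a b → part (combine a b) ≡ a
  part-combine a b = cong proj₁ (remQuot-combine a b)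

  corner : Fin m → Fin (m * n)
  corner a = combine a zero

  adj≡different-part : ∀ u v → adj G u v ≡ not ⌊ part u ≟ part v ⌋
  adj≡different-part u v = trans (cong (different ∨_) (∧-zeroʳ ⌊ part u ≟ part v ⌋)) (∨-identityʳ different)
    where different = not ⌊ part u ≟ part v ⌋

  adjacent⇔different-part : ∀ u v → adj G u v ≡ true ⇔ part u ≢ part v
  adjacent⇔different-part u v rewrite adj≡different-part u v with part u ≟ part v
  ... | yes same     = mk⇔ (λ ()) (λ different → ⊥-elim (different same))
  ... | no different = mk⇔ (λ _ → different) (λ _ → refl)

  module _ (f : Labeling G) where

    total : ℕ
    total = sumFin (m * n) (label G f)

    partSum : Fin m → ℕ
    partSum a = sumFin n (λ b → label G f (combine a b))

    partWeight : Fin m → ℕ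
    partWeight a = weight G f (corner a)

    weight≡sum-of-other-parts : ∀ u →
      weight G f u ≡ sumFin m (λ a → if not ⌊ part u ≟ a ⌋ then partSum a else 0)
    weight≡sum-of-other-parts u = begin
      weight G f u
        ≡⟨ sumFin-combine m n _ ⟩
      sumFin m (λ a → sumFin n (λ b → if adj G u (combine a b) then label G f (combine a b) else 0))
        ≡⟨ sumFin-cong m (λ a → trans (sumFin-cong n (λ b → cong (λ c → if c then label G f (combine a b) else 0)
                                                                   (adj-combine a b)))
                                      (sumFin-if n (not ⌊ part u ≟ a ⌋) (λ b → label G f (combine a b)))) ⟩
      sumFin m (λ a → if not ⌊ part u ≟ a ⌋ then partSum a else 0) ∎
      where
        open ≡-Reasoning
        adj-combine : ∀ a b → adj G u (combine a b) ≡ not ⌊ part u ≟ a ⌋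
        adj-combine a b = trans (adj≡different-part u (combine a b))
                                (cong (λ c → not ⌊ part u ≟ c ⌋) (part-combine a b))

    weight+partSum≡total : ∀ u → weight G f u + partSum (part u) ≡ total
    weight+partSum≡total u = begin
      weight G f u + partSum (part u)
        ≡⟨ cong (_+ partSum (part u)) (weight≡sum-of-other-parts u) ⟩
      sumFin m (λ a → if not ⌊ part u ≟ a ⌋ then partSum a else 0) + partSum (part u)
        ≡⟨ sumFin-except m partSum (part u) ⟩
      sumFin m partSum
        ≡⟨ sym (sumFin-combine m n (label G f)) ⟩
      total ∎
      where open ≡-Reasoning

    partWeight+partSum≡total : ∀ a → partWeight a + partSum a ≡ total
    partWeight+partSum≡total a =
      subst (λ c → partWeight a + partSum c ≡ total) (part-combine a zero) (weight+partSum≡total (corner a))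

    weight≡partWeight : ∀ u → weight G f u ≡ partWeight (part u)
    weight≡partWeight u = +-cancelʳ-≡ (partSum (part u)) _ _ (begin
      weight G f u + partSum (part u)               ≡⟨ weight+partSum≡total u ⟩
      total                                         ≡⟨ sym (partWeight+partSum≡total (part u)) ⟩
      partWeight (part u) + partSum (part u)        ∎)
      where open ≡-Reasoning

    partSum-injective⇒partWeight-injective : Injective _≡_ _≡_ partSum → Injective _≡_ _≡_ partWeight
    partSum-injective⇒partWeight-injective inj {i} {j} same = inj (+-cancelˡ-≡ (partWeight i) _ _ (begin
      partWeight i + partSum i ≡⟨ partWeight+partSum≡total i ⟩
      total                    ≡⟨ sym (partWeight+partSum≡total j) ⟩
      partWeight j + partSum j ≡⟨ cong (_+ partSum j) (sym same) ⟩
      partWeight i + partSum j ∎))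
      where open ≡-Reasoning

    isLDAL⇔partWeight-injective : IsLDAL G f ⇔ Injective _≡_ _≡_ partWeight
    isLDAL⇔partWeight-injective = mk⇔ injective isLDAL
      where
        corners-adjacent : ∀ {i j} → i ≢ j → adj G (corner i) (corner j) ≡ true
        corners-adjacent {i} {j} i≢j = Equivalence.from (adjacent⇔different-part (corner i) (corner j))
          (subst₂ _≢_ (sym (part-combine i zero)) (sym (part-combine j zero)) i≢j)

        injective : IsLDAL G f → Injective _≡_ _≡_ partWeight
        injective ldal {i} {j} same with i ≟ j
        ... | yes i≡j = i≡j
        ... | no  i≢j = ⊥-elim (ldal (corner i) (corner j) (corners-adjacent i≢j) same)

        isLDAL : Injective _≡_ _≡_ partWeight → IsLDAL G f
        isLDAL inj u v uv same = Equivalence.to (adjacent⇔different-part u v) uv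
          (inj (trans (sym (weight≡partWeight u)) (trans same (weight≡partWeight v))))

    numWeights≡m : Injective _≡_ _≡_ partWeight → numWeights G f ≡ m
    numWeights≡m =
      length-deduplicate-image ℕ._≟_ (weight G f) partWeight part corner weight≡partWeight (λ _ → refl)

    isLDAL⇒numWeights≡m : IsLDAL G f → numWeights G f ≡ m
    isLDAL⇒numWeights≡m = numWeights≡m ∘ Equivalence.to isLDAL⇔partWeight-injective

  partSum-id : ∀ a → partSum Permutation.id a ≡ n * (n * toℕ a) + sumFin n (suc ∘ toℕ)
  partSum-id a = begin
    sumFin n (λ b → suc (toℕ (combine a b)))
      ≡⟨ sumFin-cong n (λ b → trans (cong suc (toℕ-combine a b)) (sym (+-suc _ (toℕ b)))) ⟩
    sumFin n (λ b → n * toℕ a + suc (toℕ b))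
      ≡⟨ sumFin-+ n (λ _ → n * toℕ a) (suc ∘ toℕ) ⟩
    sumFin n (λ _ → n * toℕ a) + sumFin n (suc ∘ toℕ)
      ≡⟨ cong (_+ sumFin n (suc ∘ toℕ)) (sumFin-const n (n * toℕ a)) ⟩
    n * (n * toℕ a) + sumFin n (suc ∘ toℕ) ∎
    where open ≡-Reasoning

  partSum-id-injective : Injective _≡_ _≡_ (partSum Permutation.id)
  partSum-id-injective {i} {j} same = toℕ-injective (*-cancelˡ-≡ _ _ n (*-cancelˡ-≡ _ _ n
    (+-cancelʳ-≡ (sumFin n (suc ∘ toℕ)) _ _ (trans (sym (partSum-id i)) (trans same (partSum-id j))))))

  isLDAL-id : IsLDAL G Permutation.id
  isLDAL-id = Equivalence.from (isLDAL⇔partWeight-injective Permutation.id)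
                (partSum-injective⇒partWeight-injective Permutation.id partSum-id-injective)

mainTheorem18 : ∀ (m n : ℕ) → 1 ≤ m → 1 < n → ChiLdEquals (lex (K m) (Kbar n)) m
mainTheorem18 m zero      _ ()
mainTheorem18 m (suc n-1) _ _ =
  (Permutation.id , isLDAL-id , isLDAL⇒numWeights≡m Permutation.id isLDAL-id) ,
  λ f ldal → ≤-reflexive (sym (isLDAL⇒numWeights≡m f ldal))
  where open CompleteMultipartite m n-1
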